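{- Let $G=(V,E)$ be a temporal graph given as a stream $\tau$ of temporal edges in strictly increasing order of timestamps, let $\delta>0$ be a time duration, let $p\in(0,1]$, and let $\mathcal{O}:E\to\{0,1\}$ be any heaviness predictor (fixed independently of the algorithm's random coin flips). Then for every $i\in\{1,\dots,8\}$, the estimate $c_i$ output by the algorithm STEP run on $(\tau,\delta,\mathcal{O},p)$ is unbiased: $\mathbb{E}[c_i]=|\mathcal{T}_i|$. This holds regardless of the quality of the predictions of $\mathcal{O}$.
   Context: A temporal graph is $G=(V,E)$ with $V$ a finite vertex set and $E$ a finite set of directed temporal edges $(u,v,t)$ with $u\neq v\in V$ and timestamp $t\in\mathbb{R}^+$. A temporal triangle is a pair $T=((V_T,E_T),\sigma)$ where $(V_T,E_T)$ is a directed static graph with 3 vertices and 3 edges forming a triangle and $\sigma$ is an ordering of $E_T$; there are eight distinct temporal triangles $T_1,\dots,T_8$. Given $T$ whose edges ordered by $\sigma$ are $\langle (x_1,y_1),(x_2,y_2),(x_3,y_3)\rangle$, a sequence of temporally ordered edges $S=\langle (u_1,v_1,t_1),(u_2,v_2,t_2),(u_3,v_3,t_3)\rangle$ from $E$ (with $t_1<t_2<t_3$) is a $\delta$-instance of $T$ if there is a bijection $f$ on vertices with $f(u_j)=x_j$, $f(v_j)=y_j$ for $j=1,2,3$, and $t_3-t_1\le\delta$. $\mathcal{T}_i$ denotes the set of $\delta$-instances of $T_i$ in $G$. Algorithm STEP: initialize empty sets $H$ (heavy edges) and $S_L$ (sampled light edges) and counters $c_{i,0}=c_{i,1}=c_{i,2}=0$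 for $i\in[8]$. For each edge $e=(u,v,t)$ of $\tau$ in order: (1) remove from $H$ and $S_L$ all edges with timestamp $<t-\delta$; (2) for each pair of stored edges $e',e''\in H\cup S_L$ such that, ordered by time together with $e$ as last edge, they form a $\delta$-instance of $T_i$, increment $c_{i,0}$ if both $e',e''\in S_L$, $c_{i,1}$ if exactly one of them is in $H$, and $c_{i,2}$ if both are in $H$; (3) if $\mathcal{O}(e)=1$ add $e$ to $H$, else add $e$ to $S_L$ independently with probability $p$. At the end output $c_i=c_{i,0}/p^2+c_{i,1}/p+c_{i,2}$ for $i\in[8]$.
   Formalization: The timestamps, the time duration δ and the probability p are taken in the rationals rather than the reals. -}

module Defs where

open import Data.Bool using (Bool; true; false; if_then_else_)
open import Data.Nat as ℕ using (ℕ; zero; suc)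
import Data.Fin as Fin
open Fin using (Fin)
open import Data.Fin.Properties using (all?) renaming (_≟_ to _≟F_)
open import Data.Nat.Properties using () renaming (_≟_ to _≟ℕ_)
import Data.Product
open Data.Product using (_×_; _,_)
open import Data.Sum using (_⊎_)
open import Data.List using (List; []; _∷_; length; filter; map; _++_; zip; foldr; _∷ʳ_)
open import Data.List.Relation.Unary.All using (All)
open import Data.List.Relation.Unary.Linked using (Linked)
open import Data.Integer using (+_)
open import Data.Rational using (ℚ; 0ℚ; 1ℚ; _+_; _*_; _-_; _<_; _≤_; _/_; 1/_; >-nonZero)
open import Data.Rational.Properties using (_<?_; _≤?_)
open import Relation.Binary.PropositionalEquality using (_≡_; _≢_)
open import Relation.Nullary using (Dec; yes; no; ¬_; does)
open import Relation.Nullary.Decidable using (_×-dec_; _→-dec_)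

-- Temporal edges and streams.  Vertices are natural numbers (the finite
-- vertex set V is implicit: only vertices occurring in the finite edge
-- list matter).  Timestamps are rationals.

record TEdge : Set where
  constructor tedge
  field
    src     : ℕ
    dst     : ℕ
    time    : ℚ
    src≢dst : src ≢ dst
open TEdge public

ValidStream : List TEdge → Set
ValidStream τ = Linked (λ e e′ → time e < time e′) τ × All (λ e → 0ℚ < time e) τ

-- Temporal triangles.  A temporal triangle is given on the vertex set
-- Fin 3: its j-th edge in the σ-order (j = 0,1,2) is (x j , y j).

record Pattern : Set where
  constructor mkPattern
  field
    x y : Fin 3 → Fin 3
open Pattern public

SamePair : Fin 3 → Fin 3 → Fin 3 → Fin 3 → Set
SamePair a b c d = (a ≡ c × b ≡ d) ⊎ (a ≡ d × b ≡ c)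

IsTriangle : Pattern → Set
IsTriangle T = (∀ j → x T j ≢ y T j)
             × (∀ j k → j ≢ k → ¬ SamePair (x T j) (y T j) (x T k) (y T k))

slotS : (Fin 3 → TEdge) → Fin 3 → Bool → ℕ
slotS es j false = src (es j)
slotS es j true  = dst (es j)

slotT : Pattern → Fin 3 → Bool → Fin 3
slotT T j false = x T j
slotT T j true  = y T j

-- There is a bijection f from the vertices of the edge sequence to V_T
-- with f(u_j) = x_j and f(v_j) = y_j: i.e. the assignment
-- slot ↦ pattern-vertex is well defined (→) and injective (←);
-- surjectivity is automatic since a triangle uses all 3 vertices.
VertexMatch : Pattern → (Fin 3 → TEdge) → Set
VertexMatch T es = ∀ j k (b c : Bool) →
  (slotS es j b ≡ slotS es k c → slotT T j b ≡ slotT T k c)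
  × (slotT T j b ≡ slotT T k c → slotS es j b ≡ slotS es k c)

three : {A : Set} → A → A → A → Fin 3 → A
three a b c Fin.zero = a
three a b c (Fin.suc Fin.zero) = b
three a b c (Fin.suc (Fin.suc Fin.zero)) = c

IsInstance : Pattern → ℚ → TEdge → TEdge → TEdge → Set
IsInstance T δ e₁ e₂ e₃ =
  time e₁ < time e₂ × time e₂ < time e₃ × (time e₃ - time e₁ ≤ δ)
  × VertexMatch T (three e₁ e₂ e₃)

private
  allBool : {P : Bool → Set} → (∀ b → Dec (P b)) → Dec (∀ b → P b)
  allBool P? with P? false | P? true
  ... | yes pf | yes pt = yes λ { false → pf ; true → pt }
  ... | no ¬pf | _      = no λ h → ¬pf (h false)
  ... | yes _  | no ¬pt = no λ h → ¬pt (h true)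

vertexMatch? : ∀ T es → Dec (VertexMatch T es)
vertexMatch? T es =
  all? λ j → all? λ k → allBool λ b → allBool λ c →
    ((slotS es j b ≟ℕ slotS es k c) →-dec (slotT T j b ≟F slotT T k c))
    ×-dec ((slotT T j b ≟F slotT T k c) →-dec (slotS es j b ≟ℕ slotS es k c))

isInstance? : ∀ T δ e₁ e₂ e₃ → Dec (IsInstance T δ e₁ e₂ e₃)
isInstance? T δ e₁ e₂ e₃ =
  (time e₁ <? time e₂) ×-dec (time e₂ <? time e₃) ×-dec (time e₃ - time e₁ ≤? δ)
  ×-dec vertexMatch? T (three e₁ e₂ e₃)

-- Since timestamps strictly increase along τ, temporally ordered
-- sequences of three edges from E are exactly the length-3 sublists of τ.

pairs : {A : Set} → List A → List (A × A)
pairs []       = []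
pairs (a ∷ as) = map (λ b → a , b) as ++ pairs as

triples : {A : Set} → List A → List (A × A × A)
triples []       = []
triples (a ∷ as) = map (λ { (b , c) → a , b , c }) (pairs as) ++ triples as

numInstances : Pattern → ℚ → List TEdge → ℕ
numInstances T δ τ =
  length (filter (λ { (a , b , c) → isInstance? T δ a b c }) (triples τ))

-- Algorithm STEP (for one fixed temporal triangle T; the counters of the
-- different triangles do not interact).

-- Stored edges in arrival (= time) order, tagged true if in H, false if in S_L.
record State : Set where
  constructor state
  field
    stored : List (TEdge × Bool)
    c₀ c₁ c₂ : ℕ
open State public

bump : TEdge × Bool → TEdge × Bool → ℕ × ℕ × ℕ → ℕ × ℕ × ℕ
bump (_ , false) (_ , false) (a , b , c) = suc a , b , c
bump (_ , true)  (_ , true)  (a , b , c) = a , b , suc c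
bump _           _           (a , b , c) = a , suc b , c

-- Processing edge e with coin flip `coin` (coin = true means "e is
-- sampled", which happens with probability p; unused if 𝒪(e) = 1).
stepEdge : Pattern → ℚ → (TEdge → Bool) → State → TEdge × Bool → State
stepEdge T δ O (state st a b c) (e , coin) =
  let
      st₁ = filter (λ s → time e - δ ≤? time (Data.Product.proj₁ s)) st
      cnt = foldr (λ { (s , s′) acc →
                      if does (isInstance? T δ (Data.Product.proj₁ s) (Data.Product.proj₁ s′) e)
                      then bump s s′ acc else acc })
                  (a , b , c) (pairs st₁)
      st₂ = if O e then st₁ ∷ʳ (e , true)
            else (if coin then st₁ ∷ʳ (e , false) else st₁)
  in state st₂ (Data.Product.proj₁ cnt)
               (Data.Product.proj₁ (Data.Product.proj₂ cnt))
               (Data.Product.proj₂ (Data.Product.proj₂ cnt))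

runSTEP : Pattern → ℚ → (TEdge → Bool) → List TEdge → List Bool → State
runSTEP T δ O τ coins = foldl′ (state [] 0 0 0) (zip τ coins)
  where
  foldl′ : State → List (TEdge × Bool) → State
  foldl′ s []       = s
  foldl′ s (x ∷ xs) = foldl′ (stepEdge T δ O s x) xs

ℕtoℚ : ℕ → ℚ
ℕtoℚ n = (+ n) / 1

output : (p : ℚ) → 0ℚ < p → State → ℚ
output p p>0 s =
  ℕtoℚ (c₀ s) * (q * q) + ℕtoℚ (c₁ s) * q + ℕtoℚ (c₂ s)
  where q = 1/_ p {{>-nonZero p>0}}

-- Probability space: one independent coin per stream edge, true with
-- probability p.  Expectation = Σ over all 2^n outcomes of
-- Pr[outcome] · value.

allCoins : ℕ → List (List Bool)
allCoins zero    = [] ∷ []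
allCoins (suc n) = map (true ∷_) (allCoins n) ++ map (false ∷_) (allCoins n)

prob : ℚ → List Bool → ℚ
prob p = foldr (λ b acc → (if b then p else 1ℚ - p) * acc) 1ℚ

sumℚ : List ℚ → ℚ
sumℚ = foldr _+_ 0ℚ

expectedOutput : Pattern → ℚ → (TEdge → Bool) → (p : ℚ) → 0ℚ < p → List TEdge → ℚ
expectedOutput T δ O p p>0 τ =
  sumℚ (map (λ coins → prob p coins * output p p>0 (runSTEP T δ O τ coins))
            (allCoins (length τ)))

-- Give each stored edge a weight: 1 if it is in H, 1/p if it is a sampled light edge, the inverse
-- of the probability that it is stored. An instance detected with k edges from H adds (1/p)^(2-k)
-- to c_i, so c_i is the sum, over detected instances, of the product of the weights of their two
-- stored edges. For stored weighted edges L and the rest τ of the stream, let Ψ(L, τ)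
-- (streamCompletions) be the same weighted count of the instances closed by edges of τ if every
-- later edge is stored with weight 1. Then "expected final c_i = current c_i + Ψ(stored edges, rest
-- of the stream)" survives every step of STEP: Ψ is affine in the weight of each stored edge, so
-- storing a light edge with weight 1/p with probability p has, on average, the effect of weight 1;
-- and discarding an edge older than t - δ changes nothing, since it can no longer be in a
-- δ-instance closed at time ≥ t. Initially c_i = 0 and Ψ([], τ) = |𝒯_i|.

module Submission where

open import Defs
open import Data.Bool using (Bool; true; false; if_then_else_)
open import Data.Nat using (ℕ; zero; suc)
open import Data.List using (List; []; _∷_; [_]; foldr; foldl; zip; _++_; _∷ʳ_; map; filter; length)
open import Data.List.Properties using (map-∘; map-++; ++-identityʳ; ++-assoc)
open import Data.Product using (_×_; _,_; proj₁; proj₂; uncurry; map₂)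
open import Data.List.Relation.Unary.All as All using (All; []; _∷_)
open import Data.List.Relation.Unary.Linked as Linked using (Linked)
open import Data.List.Relation.Unary.Linked.Properties using (Linked⇒All)
open import Data.Rational using (ℚ; 0ℚ; 1ℚ; _+_; _*_; _-_; -_; _≤_; _<_; 1/_; >-nonZero; toℚᵘ)
open import Data.Rational.Properties
  using (+-identityˡ; +-identityʳ; +-assoc; *-zeroʳ; *-identityˡ; *-assoc; *-comm; *-distribˡ-+; *-inverseʳ;
         ≤-refl; ≤-trans; <⇒≤; +-monoˡ-≤; _≤?_; toℚᵘ-injective; toℚᵘ-homo-+; normalize-coprime)
open import Data.Rational.Solver using (module +-*-Solver)
import Data.Integer as ℤ
import Data.Integer.Properties as ℤ
open import Data.Nat.Coprimality as Coprime using (1-coprimeTo)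
import Data.Rational.Unnormalised as ℚᵘ
import Data.Rational.Unnormalised.Properties as ℚᵘ
open import Function using (_∘_)
open import Relation.Nullary using (yes; no; does; ¬_)
open import Relation.Unary using (Decidable)
open import Relation.Nullary.Decidable using (dec-false)
open import Relation.Binary.PropositionalEquality
  using (_≡_; refl; sym; trans; cong; cong₂; subst₂; module ≡-Reasoning)
open +-*-Solver

private variable A B : Set

Σ : (A → ℚ) → List A → ℚ
Σ f xs = sumℚ (map f xs)

Σ-++ : (f : A → ℚ) (xs ys : List A) → Σ f (xs ++ ys) ≡ Σ f xs + Σ f ys
Σ-++ f []       ys = sym (+-identityˡ _)
Σ-++ f (x ∷ xs) ys = trans (cong (f x +_) (Σ-++ f xs ys))
  (sym (+-assoc (f x) (Σ f xs) (Σ f ys)))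

Σ-cong : {f g : A → ℚ} → (∀ x → f x ≡ g x) → (xs : List A) → Σ f xs ≡ Σ g xs
Σ-cong f≗g []       = refl
Σ-cong f≗g (x ∷ xs) = cong₂ _+_ (f≗g x) (Σ-cong f≗g xs)

Σ-map : (f : B → ℚ) (h : A → B) (xs : List A) → Σ f (map h xs) ≡ Σ (f ∘ h) xs
Σ-map f h xs = cong sumℚ (sym (map-∘ xs))

*-distribˡ-Σ : (k : ℚ) (f : A → ℚ) (xs : List A) → k * Σ f xs ≡ Σ (λ x → k * f x) xs
*-distribˡ-Σ k f []       = *-zeroʳ k
*-distribˡ-Σ k f (x ∷ xs) = trans (*-distribˡ-+ k (f x) (Σ f xs)) (cong (k * f x +_) (*-distribˡ-Σ k f xs))

Σ-≡0 : {f : A → ℚ} → (∀ x → f x ≡ 0ℚ) → (xs : List A) → Σ f xs ≡ 0ℚ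
Σ-≡0 f≗0 []       = refl
Σ-≡0 f≗0 (x ∷ xs) = trans (cong₂ _+_ (f≗0 x) (Σ-≡0 f≗0 xs)) (+-identityʳ 0ℚ)

Σ< : (A → A → ℚ) → List A → ℚ
Σ< f []       = 0ℚ
Σ< f (x ∷ xs) = Σ (f x) xs + Σ< f xs

Σ-pairs : (f : A → A → ℚ) (xs : List A) → Σ (uncurry f) (pairs xs) ≡ Σ< f xs
Σ-pairs f []       = refl
Σ-pairs f (x ∷ xs) = begin
  Σ (uncurry f) (map (x ,_) xs ++ pairs xs)
    ≡⟨ Σ-++ (uncurry f) (map (x ,_) xs) (pairs xs) ⟩
  Σ (uncurry f) (map (x ,_) xs) + Σ (uncurry f) (pairs xs)
    ≡⟨ cong₂ _+_ (Σ-map (uncurry f) (x ,_) xs) (Σ-pairs f xs) ⟩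
  Σ (f x) xs + Σ< f xs
    ∎
  where open ≡-Reasoning

Σ<-cong : {f g : A → A → ℚ} → (∀ x y → f x y ≡ g x y) → (xs : List A) → Σ< f xs ≡ Σ< g xs
Σ<-cong f≗g []       = refl
Σ<-cong f≗g (x ∷ xs) = cong₂ _+_ (Σ-cong (f≗g x) xs) (Σ<-cong f≗g xs)

Σ<-map : (f : B → B → ℚ) (h : A → B) (xs : List A) →
         Σ< f (map h xs) ≡ Σ< (λ x y → f (h x) (h y)) xs
Σ<-map f h []       = refl
Σ<-map f h (x ∷ xs) = cong₂ _+_ (Σ-map (f (h x)) h xs) (Σ<-map f h xs)

Σ<-insert : (f : A → A → ℚ) (as : List A) (x : A) (bs : List A) →
  Σ< f (as ++ x ∷ bs) ≡ Σ< f (as ++ bs) + (Σ (λ a → f a x) as + Σ (f x) bs)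
Σ<-insert f []       x bs =
  solve 2 (λ u v → u :+ v := v :+ (con 0ℚ :+ u)) refl (Σ (f x) bs) (Σ< f bs)
Σ<-insert f (a ∷ as) x bs = begin
  Σ (f a) (as ++ x ∷ bs) + Σ< f (as ++ x ∷ bs)
    ≡⟨ cong₂ _+_ (Σ-++ (f a) as (x ∷ bs)) (Σ<-insert f as x bs) ⟩
  (α + (f a x + β)) + (σ + (κ + ρ))
    ≡⟨ solve 6 (λ α fax β σ κ ρ → (α :+ (fax :+ β)) :+ (σ :+ (κ :+ ρ))
                               := ((α :+ β) :+ σ) :+ ((fax :+ κ) :+ ρ))
               refl α (f a x) β σ κ ρ ⟩
  ((α + β) + σ) + ((f a x + κ) + ρ)
    ≡⟨ cong (λ t → (t + σ) + ((f a x + κ) + ρ)) (sym (Σ-++ (f a) as bs)) ⟩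
  (Σ (f a) (as ++ bs) + σ) + ((f a x + κ) + ρ)
    ∎
  where
  open ≡-Reasoning
  α β σ κ ρ : ℚ
  α  = Σ (f a) as
  β  = Σ (f a) bs
  σ  = Σ< f (as ++ bs)
  κ  = Σ (λ a → f a x) as
  ρ  = Σ (f x) bs

Σ<-∷ʳ : (f : A → A → ℚ) (xs : List A) (z : A) → Σ< f (xs ∷ʳ z) ≡ Σ< f xs + Σ (λ a → f a z) xs
Σ<-∷ʳ f xs z = begin
  Σ< f (xs ++ z ∷ [])
    ≡⟨ Σ<-insert f xs z [] ⟩
  Σ< f (xs ++ []) + (Σ (λ a → f a z) xs + 0ℚ)
    ≡⟨ cong₂ (λ ys t → Σ< f ys + t) (++-identityʳ xs) (+-identityʳ _) ⟩
  Σ< f xs + Σ (λ a → f a z) xs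
    ∎
  where open ≡-Reasoning

Σ<< : (A → A → A → ℚ) → List A → ℚ
Σ<< g xs = Σ (λ (a , b , c) → g a b c) (triples xs)

Σ<<-∷ : (g : A → A → A → ℚ) (x : A) (xs : List A) → Σ<< g (x ∷ xs) ≡ Σ< (g x) xs + Σ<< g xs
Σ<<-∷ g x xs = trans (Σ-++ _ (map (x ,_) (pairs xs)) (triples xs))
                     (cong (_+ Σ<< g xs) (trans (Σ-map _ (x ,_) (pairs xs)) (Σ-pairs (g x) xs)))

Σ<<-∷ʳ : (g : A → A → A → ℚ) (xs : List A) (z : A) →
         Σ<< g (xs ∷ʳ z) ≡ Σ<< g xs + Σ< (λ a b → g a b z) xs
Σ<<-∷ʳ g []       z = sym (+-identityˡ _)
Σ<<-∷ʳ g (x ∷ xs) z = begin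
  Σ<< g ((x ∷ xs) ∷ʳ z)
    ≡⟨ Σ<<-∷ g x (xs ∷ʳ z) ⟩
  Σ< (g x) (xs ∷ʳ z) + Σ<< g (xs ∷ʳ z)
    ≡⟨ cong₂ _+_ (Σ<-∷ʳ (g x) xs z) (Σ<<-∷ʳ g xs z) ⟩
  (Σ< (g x) xs + xz) + (Σ<< g xs + Σ< (λ a b → g a b z) xs)
    ≡⟨ solve 4 (λ a b c d → (a :+ b) :+ (c :+ d) := (a :+ c) :+ (b :+ d)) refl
         (Σ< (g x) xs) xz (Σ<< g xs) (Σ< (λ a b → g a b z) xs) ⟩
  (Σ< (g x) xs + Σ<< g xs) + (xz + Σ< (λ a b → g a b z) xs)
    ≡⟨ cong (_+ (xz + Σ< (λ a b → g a b z) xs)) (sym (Σ<<-∷ g x xs)) ⟩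
  Σ<< g (x ∷ xs) + Σ< (λ a b → g a b z) (x ∷ xs)
    ∎
  where
  open ≡-Reasoning
  xz : ℚ
  xz = Σ (λ b → g x b z) xs

𝟙 : Bool → ℚ
𝟙 b = if b then 1ℚ else 0ℚ

ℕtoℚ-suc : ∀ n → ℕtoℚ (suc n) ≡ 1ℚ + ℕtoℚ n
ℕtoℚ-suc n = toℚᵘ-injective (begin
  toℚᵘ (ℕtoℚ (suc n))             ≡⟨ toℚᵘ-ℕtoℚ (suc n) ⟩
  ℚᵘ.mkℚᵘ (ℤ.+ suc n) 0          ≈⟨ ℚᵘ.*≡* (cong (λ m → (ℤ.+ 1 ℤ.+ m) ℤ.* ℤ.+ 1) (sym (ℤ.*-identityʳ (ℤ.+ n)))) ⟩
  toℚᵘ 1ℚ ℚᵘ.+ ℚᵘ.mkℚᵘ (ℤ.+ n) 0  ≡⟨ cong (toℚᵘ 1ℚ ℚᵘ.+_) (sym (toℚᵘ-ℕtoℚ n)) ⟩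
  toℚᵘ 1ℚ ℚᵘ.+ toℚᵘ (ℕtoℚ n)      ≈⟨ ℚᵘ.≃-sym (toℚᵘ-homo-+ 1ℚ (ℕtoℚ n)) ⟩
  toℚᵘ (1ℚ + ℕtoℚ n)              ∎)
  where
  open ℚᵘ.≃-Reasoning
  toℚᵘ-ℕtoℚ : ∀ n → toℚᵘ (ℕtoℚ n) ≡ ℚᵘ.mkℚᵘ (ℤ.+ n) 0
  toℚᵘ-ℕtoℚ n = cong toℚᵘ (normalize-coprime (Coprime.sym (1-coprimeTo n)))

ℕtoℚ-length-filter : {P : A → Set} (P? : Decidable P) (xs : List A) →
                     ℕtoℚ (length (filter P? xs)) ≡ Σ (𝟙 ∘ does ∘ P?) xs
ℕtoℚ-length-filter P? []       = refl
ℕtoℚ-length-filter P? (x ∷ xs) with does (P? x)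
... | true  = trans (ℕtoℚ-suc (length (filter P? xs))) (cong (1ℚ +_) (ℕtoℚ-length-filter P? xs))
... | false = trans (ℕtoℚ-length-filter P? xs) (sym (+-identityˡ _))

module Expectation (p : ℚ) where

  𝔼 : ℕ → (List Bool → ℚ) → ℚ
  𝔼 n g = Σ (λ c → prob p c * g c) (allCoins n)

  𝔼-zero : (g : List Bool → ℚ) → 𝔼 zero g ≡ g []
  𝔼-zero g = trans (+-identityʳ _) (*-identityˡ _)

  𝔼-suc : ∀ n (g : List Bool → ℚ) →
          𝔼 (suc n) g ≡ p * 𝔼 n (g ∘ (true ∷_)) + (1ℚ - p) * 𝔼 n (g ∘ (false ∷_))
  𝔼-suc n g = begin
    Σ h (map (true ∷_) cs ++ map (false ∷_) cs)
      ≡⟨ Σ-++ h (map (true ∷_) cs) (map (false ∷_) cs) ⟩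
    Σ h (map (true ∷_) cs) + Σ h (map (false ∷_) cs)
      ≡⟨ cong₂ _+_ (trans (Σ-map h (true ∷_) cs) (Σ-first-coin p (g ∘ (true ∷_))))
                   (trans (Σ-map h (false ∷_) cs) (Σ-first-coin (1ℚ - p) (g ∘ (false ∷_)))) ⟩
    p * 𝔼 n (g ∘ (true ∷_)) + (1ℚ - p) * 𝔼 n (g ∘ (false ∷_))
      ∎
    where
    open ≡-Reasoning
    cs : List (List Bool)
    cs = allCoins n
    h : List Bool → ℚ
    h c = prob p c * g c
    Σ-first-coin : ∀ k (g′ : List Bool → ℚ) → Σ (λ c → (k * prob p c) * g′ c) cs ≡ k * 𝔼 n g′
    Σ-first-coin k g′ = trans (Σ-cong (λ c → *-assoc k (prob p c) (g′ c)) cs)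
                              (sym (*-distribˡ-Σ k (λ c → prob p c * g′ c) cs))

module Completions {A : Set} (ι : A → A → A → Bool) where

  Weighted : Set
  Weighted = List (A × ℚ)

  pairWeight : A → A × ℚ → A × ℚ → ℚ
  pairWeight z (x , u) (y , v) = if ι x y z then u * v else 0ℚ

  completions : Weighted → A → ℚ
  completions L z = Σ< (pairWeight z) L

  streamCompletions : Weighted → List A → ℚ
  streamCompletions L []      = 0ℚ
  streamCompletions L (z ∷ τ) = completions L z + streamCompletions (L ∷ʳ (z , 1ℚ)) τ

  involvement : Weighted → A → Weighted → A → ℚ
  involvement as x bs z = Σ (λ (a , u) → if ι a x z then u else 0ℚ) as
                        + Σ (λ (b , v) → if ι x b z then v else 0ℚ) bs

  streamInvolvement : Weighted → A → Weighted → List A → ℚ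
  streamInvolvement as x bs []      = 0ℚ
  streamInvolvement as x bs (z ∷ τ) = involvement as x bs z + streamInvolvement as x (bs ∷ʳ (z , 1ℚ)) τ

  completions-insert : ∀ as x w bs z →
    completions (as ++ (x , w) ∷ bs) z ≡ completions (as ++ bs) z + w * involvement as x bs z
  completions-insert as x w bs z = begin
    completions (as ++ (x , w) ∷ bs) z
      ≡⟨ Σ<-insert (pairWeight z) as (x , w) bs ⟩
    completions (as ++ bs) z + (Σ (λ a → pairWeight z a (x , w)) as + Σ (pairWeight z (x , w)) bs)
      ≡⟨ cong (completions (as ++ bs) z +_) (cong₂ _+_
           (trans (Σ-cong weight-before as) (sym (*-distribˡ-Σ w _ as)))
           (trans (Σ-cong weight-after bs) (sym (*-distribˡ-Σ w _ bs)))) ⟩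
    completions (as ++ bs) z + (w * Σ (λ (a , u) → if ι a x z then u else 0ℚ) as
                               + w * Σ (λ (b , v) → if ι x b z then v else 0ℚ) bs)
      ≡⟨ cong (completions (as ++ bs) z +_) (sym (*-distribˡ-+ w _ _)) ⟩
    completions (as ++ bs) z + w * involvement as x bs z
      ∎
    where
    open ≡-Reasoning
    weight-before : ∀ ((a , u) : A × ℚ) → pairWeight z (a , u) (x , w) ≡ w * (if ι a x z then u else 0ℚ)
    weight-before (a , u) with ι a x z
    ... | true  = *-comm u w
    ... | false = sym (*-zeroʳ w)
    weight-after : ∀ ((b , v) : A × ℚ) → pairWeight z (x , w) (b , v) ≡ w * (if ι x b z then v else 0ℚ)
    weight-after (b , v) with ι x b z
    ... | true  = refl
    ... | false = sym (*-zeroʳ w)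

  streamCompletions-insert : ∀ τ as x w bs →
    streamCompletions (as ++ (x , w) ∷ bs) τ ≡ streamCompletions (as ++ bs) τ + w * streamInvolvement as x bs τ
  streamCompletions-insert []      as x w bs = sym (trans (cong (0ℚ +_) (*-zeroʳ w)) (+-identityʳ 0ℚ))
  streamCompletions-insert (z ∷ τ) as x w bs = begin
    completions (as ++ (x , w) ∷ bs) z + streamCompletions ((as ++ (x , w) ∷ bs) ∷ʳ (z , 1ℚ)) τ
      ≡⟨ cong₂ _+_ (completions-insert as x w bs z)
                   (cong (λ L → streamCompletions L τ) (++-assoc as ((x , w) ∷ bs) [ z , 1ℚ ])) ⟩
    (C + w * I) + streamCompletions (as ++ (x , w) ∷ bs′) τ
      ≡⟨ cong ((C + w * I) +_) (streamCompletions-insert τ as x w bs′) ⟩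
    (C + w * I) + (streamCompletions (as ++ bs′) τ + w * streamInvolvement as x bs′ τ)
      ≡⟨ solve 5 (λ c w i s j → (c :+ w :* i) :+ (s :+ w :* j) := (c :+ s) :+ w :* (i :+ j)) refl
           C w I (streamCompletions (as ++ bs′) τ) (streamInvolvement as x bs′ τ) ⟩
    (C + streamCompletions (as ++ bs′) τ) + w * streamInvolvement as x bs (z ∷ τ)
      ≡⟨ cong (λ L → (C + streamCompletions L τ) + w * streamInvolvement as x bs (z ∷ τ))
              (sym (++-assoc as bs [ z , 1ℚ ])) ⟩
    streamCompletions (as ++ bs) (z ∷ τ) + w * streamInvolvement as x bs (z ∷ τ)
      ∎
    where
    open ≡-Reasoning
    bs′ : Weighted
    bs′ = bs ∷ʳ (z , 1ℚ)
    C I : ℚ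
    C = completions (as ++ bs) z
    I = involvement as x bs z

  streamCompletions-sample : ∀ p τ as x w bs →
    p * streamCompletions (as ++ (x , w) ∷ bs) τ + (1ℚ - p) * streamCompletions (as ++ bs) τ
    ≡ streamCompletions (as ++ (x , p * w) ∷ bs) τ
  streamCompletions-sample p τ as x w bs = begin
    p * streamCompletions (as ++ (x , w) ∷ bs) τ + (1ℚ - p) * S
      ≡⟨ cong (λ t → p * t + (1ℚ - p) * S) (streamCompletions-insert τ as x w bs) ⟩
    p * (S + w * I) + (1ℚ - p) * S
      ≡⟨ solve 4 (λ p w s i → p :* (s :+ w :* i) :+ (con 1ℚ :- p) :* s := s :+ (p :* w) :* i) refl p w S I ⟩
    S + (p * w) * I
      ≡⟨ sym (streamCompletions-insert τ as x (p * w) bs) ⟩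
    streamCompletions (as ++ (x , p * w) ∷ bs) τ
      ∎
    where
    open ≡-Reasoning
    S I : ℚ
    S = streamCompletions (as ++ bs) τ
    I = streamInvolvement as x bs τ

  Inert : A → List A → Set
  Inert x τ = All (λ z → ∀ y → ι y x z ≡ false × ι x y z ≡ false) τ

  streamInvolvement-inert : ∀ {x τ} → Inert x τ → ∀ as bs → streamInvolvement as x bs τ ≡ 0ℚ
  streamInvolvement-inert []                    as bs = refl
  streamInvolvement-inert {x} {z ∷ τ} (xz ∷ xτ) as bs = begin
    involvement as x bs z + streamInvolvement as x (bs ∷ʳ (z , 1ℚ)) τ
      ≡⟨ cong₂ _+_ (cong₂ _+_ (Σ-≡0 not-before as) (Σ-≡0 not-after bs))
                   (streamInvolvement-inert xτ as (bs ∷ʳ (z , 1ℚ))) ⟩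
    (0ℚ + 0ℚ) + 0ℚ
      ≡⟨⟩
    0ℚ
      ∎
    where
    open ≡-Reasoning
    not-before : ∀ ((a , u) : A × ℚ) → (if ι a x z then u else 0ℚ) ≡ 0ℚ
    not-before (a , u) rewrite proj₁ (xz a) = refl
    not-after : ∀ ((b , v) : A × ℚ) → (if ι x b z then v else 0ℚ) ≡ 0ℚ
    not-after (b , v) rewrite proj₂ (xz b) = refl

  streamCompletions-inert : ∀ {x τ} → Inert x τ → ∀ as w bs →
    streamCompletions (as ++ (x , w) ∷ bs) τ ≡ streamCompletions (as ++ bs) τ
  streamCompletions-inert {x} {τ} xτ as w bs = begin
    streamCompletions (as ++ (x , w) ∷ bs) τ
      ≡⟨ streamCompletions-insert τ as x w bs ⟩
    S + w * streamInvolvement as x bs τ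
      ≡⟨ cong (λ t → S + w * t) (streamInvolvement-inert xτ as bs) ⟩
    S + w * 0ℚ
      ≡⟨ solve 2 (λ s w → s :+ w :* con 0ℚ := s) refl S w ⟩
    S
      ∎
    where
    open ≡-Reasoning
    S : ℚ
    S = streamCompletions (as ++ bs) τ

  streamCompletions-filter : {τ : List A} {P : B → Set} (P? : Decidable P) (f : B → A × ℚ) →
    (∀ s → ¬ P s → Inert (proj₁ (f s)) τ) →
    ∀ as ss → streamCompletions (as ++ map f (filter P? ss)) τ ≡ streamCompletions (as ++ map f ss) τ
  streamCompletions-filter P? f inert as []       = refl
  streamCompletions-filter {τ = τ} P? f inert as (s ∷ ss) with P? s
  ... | yes _  = begin
    streamCompletions (as ++ f s ∷ map f (filter P? ss)) τ
      ≡⟨ cong (λ L → streamCompletions L τ) (sym (++-assoc as [ f s ] (map f (filter P? ss)))) ⟩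
    streamCompletions ((as ∷ʳ f s) ++ map f (filter P? ss)) τ
      ≡⟨ streamCompletions-filter P? f inert (as ∷ʳ f s) ss ⟩
    streamCompletions ((as ∷ʳ f s) ++ map f ss) τ
      ≡⟨ cong (λ L → streamCompletions L τ) (++-assoc as [ f s ] (map f ss)) ⟩
    streamCompletions (as ++ f s ∷ map f ss) τ
      ∎
    where open ≡-Reasoning
  ... | no ¬Ps = trans (streamCompletions-filter P? f inert as ss)
                       (sym (streamCompletions-inert (inert s ¬Ps) as (proj₂ (f s)) (map f ss)))

  ι𝟙 : A → A → A → ℚ
  ι𝟙 a b c = 𝟙 (ι a b c)

  completions-unit : ∀ xs z → completions (map (_, 1ℚ) xs) z ≡ Σ< (λ a b → ι𝟙 a b z) xs
  completions-unit xs z = trans (Σ<-map (pairWeight z) (_, 1ℚ) xs) (Σ<-cong unit-weight xs)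
    where
    unit-weight : ∀ a b → pairWeight z (a , 1ℚ) (b , 1ℚ) ≡ ι𝟙 a b z
    unit-weight a b with ι a b z
    ... | true  = refl
    ... | false = refl

  streamCompletions-unit : ∀ τ xs → Σ<< ι𝟙 xs + streamCompletions (map (_, 1ℚ) xs) τ ≡ Σ<< ι𝟙 (xs ++ τ)
  streamCompletions-unit []      xs = trans (+-identityʳ _) (cong (Σ<< ι𝟙) (sym (++-identityʳ xs)))
  streamCompletions-unit (z ∷ τ) xs = begin
    Σ<< ι𝟙 xs + (completions (map (_, 1ℚ) xs) z + streamCompletions (map (_, 1ℚ) xs ∷ʳ (z , 1ℚ)) τ)
      ≡⟨ cong (Σ<< ι𝟙 xs +_) (cong₂ (λ c L → c + streamCompletions L τ)
                                     (completions-unit xs z) (sym (map-++ (_, 1ℚ) xs [ z ]))) ⟩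
    Σ<< ι𝟙 xs + (closedByZ + rest)
      ≡⟨ sym (+-assoc (Σ<< ι𝟙 xs) closedByZ rest) ⟩
    (Σ<< ι𝟙 xs + closedByZ) + rest
      ≡⟨ cong (_+ rest) (sym (Σ<<-∷ʳ ι𝟙 xs z)) ⟩
    Σ<< ι𝟙 (xs ∷ʳ z) + rest
      ≡⟨ streamCompletions-unit τ (xs ∷ʳ z) ⟩
    Σ<< ι𝟙 ((xs ∷ʳ z) ++ τ)
      ≡⟨ cong (Σ<< ι𝟙) (++-assoc xs [ z ] τ) ⟩
    Σ<< ι𝟙 (xs ++ z ∷ τ)
      ∎
    where
    open ≡-Reasoning
    closedByZ rest : ℚ
    closedByZ = Σ< (λ a b → ι𝟙 a b z) xs
    rest      = streamCompletions (map (_, 1ℚ) (xs ∷ʳ z)) τ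

isInstanceᵇ : Pattern → ℚ → TEdge → TEdge → TEdge → Bool
isInstanceᵇ T δ a b c = does (isInstance? T δ a b c)

p-q≤r⇒p-r≤q : ∀ p q r → p - q ≤ r → p - r ≤ q
p-q≤r⇒p-r≤q p q r p-q≤r = subst₂ _≤_
  (solve 3 (λ p q r → (p :- q) :+ (q :- r) := p :- r) refl p q r)
  (solve 2 (λ q r → r :+ (q :- r) := q) refl q r)
  (+-monoˡ-≤ (q - r) p-q≤r)

module Expiry (T : Pattern) (δ : ℚ) where
  open Completions (isInstanceᵇ T δ)

  expired-inert : ∀ {t x τ} → ¬ (t - δ ≤ time x) → All (λ z → t ≤ time z) τ → Inert x τ
  expired-inert {t} {x} expired = All.map λ {z} t≤z →
    let t-δ≤z-δ = +-monoˡ-≤ (- δ) t≤z in λ y →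
      dec-false (isInstance? T δ y x z) (λ (y<x , _ , z-y≤δ , _) →
        expired (≤-trans t-δ≤z-δ (≤-trans (p-q≤r⇒p-r≤q (time z) (time y) δ z-y≤δ) (<⇒≤ y<x))))
    , dec-false (isInstance? T δ x y z) (λ (_ , _ , z-x≤δ , _) →
        expired (≤-trans t-δ≤z-δ (p-q≤r⇒p-r≤q (time z) (time x) δ z-x≤δ)))

  expire : TEdge → List (TEdge × Bool) → List (TEdge × Bool)
  expire e = filter (λ s → time e - δ ≤? time (proj₁ s))

  streamCompletions-expire : ∀ {e τ} → Linked (λ a b → time a < time b) (e ∷ τ) →
    ∀ (weight : Bool → ℚ) st →
    streamCompletions (map (map₂ weight) (expire e st)) (e ∷ τ) ≡ streamCompletions (map (map₂ weight) st) (e ∷ τ)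
  streamCompletions-expire {e} {τ} sorted weight =
    streamCompletions-filter (λ s → time e - δ ≤? time (proj₁ s)) (map₂ weight)
      (λ _ expired → expired-inert expired later) []
    where
    later : All (λ z → time e ≤ time z) (e ∷ τ)
    later = Linked⇒All {R = λ a b → time a ≤ time b} ≤-trans {v = e} ≤-refl (Linked.map <⇒≤ sorted)

module STEP (T : Pattern) (δ : ℚ) (O : TEdge → Bool) (p : ℚ) (p>0 : 0ℚ < p) where
  open Completions (isInstanceᵇ T δ)
  open Expiry T δ
  open Expectation p

  q : ℚ
  q = 1/_ p {{>-nonZero p>0}}

  weight : Bool → ℚ
  weight true  = 1ℚ
  weight false = q

  weighted : List (TEdge × Bool) → Weighted
  weighted = map (map₂ weight)

  counterValue : ℕ × ℕ × ℕ → ℚ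
  counterValue (a , b , c) = ℕtoℚ a * (q * q) + ℕtoℚ b * q + ℕtoℚ c

  value : State → ℚ
  value = output p p>0

  counterValue-bump : ∀ s s′ acc →
    counterValue (bump s s′ acc) ≡ counterValue acc + weight (proj₂ s) * weight (proj₂ s′)
  counterValue-bump (_ , false) (_ , false) (a , b , c) rewrite ℕtoℚ-suc a =
    solve 4 (λ A B C q → (con 1ℚ :+ A) :* (q :* q) :+ B :* q :+ C
                       := (A :* (q :* q) :+ B :* q :+ C) :+ q :* q)
            refl (ℕtoℚ a) (ℕtoℚ b) (ℕtoℚ c) q
  counterValue-bump (_ , true)  (_ , true)  (a , b , c) rewrite ℕtoℚ-suc c =
    solve 4 (λ A B C q → A :* (q :* q) :+ B :* q :+ (con 1ℚ :+ C)
                       := (A :* (q :* q) :+ B :* q :+ C) :+ con 1ℚ :* con 1ℚ)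
            refl (ℕtoℚ a) (ℕtoℚ b) (ℕtoℚ c) q
  counterValue-bump (_ , true)  (_ , false) (a , b , c) rewrite ℕtoℚ-suc b =
    solve 4 (λ A B C q → A :* (q :* q) :+ (con 1ℚ :+ B) :* q :+ C
                       := (A :* (q :* q) :+ B :* q :+ C) :+ con 1ℚ :* q)
            refl (ℕtoℚ a) (ℕtoℚ b) (ℕtoℚ c) q
  counterValue-bump (_ , false) (_ , true)  (a , b , c) rewrite ℕtoℚ-suc b =
    solve 4 (λ A B C q → A :* (q :* q) :+ (con 1ℚ :+ B) :* q :+ C
                       := (A :* (q :* q) :+ B :* q :+ C) :+ q :* con 1ℚ)
            refl (ℕtoℚ a) (ℕtoℚ b) (ℕtoℚ c) q

  -- stepEdge counts with a pattern lambda, which can only be described by its equation.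
  counterValue-foldr-bump : ∀ e {g : (TEdge × Bool) × (TEdge × Bool) → ℕ × ℕ × ℕ → ℕ × ℕ × ℕ} →
    (∀ s s′ acc → g (s , s′) acc ≡ (if isInstanceᵇ T δ (proj₁ s) (proj₁ s′) e then bump s s′ acc else acc)) →
    ∀ ps acc → counterValue (foldr g acc ps)
             ≡ counterValue acc + Σ (λ (s , s′) → pairWeight e (map₂ weight s) (map₂ weight s′)) ps
  counterValue-foldr-bump e g-bumps []               acc = sym (+-identityʳ _)
  counterValue-foldr-bump e {g} g-bumps ((s , s′) ∷ ps) acc = begin
    counterValue (g (s , s′) r)
      ≡⟨ cong counterValue (g-bumps s s′ r) ⟩
    counterValue (if isInstanceᵇ T δ (proj₁ s) (proj₁ s′) e then bump s s′ r else r)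
      ≡⟨ counterValue-if (isInstanceᵇ T δ (proj₁ s) (proj₁ s′) e) ⟩
    counterValue r + w
      ≡⟨ cong (_+ w) (counterValue-foldr-bump e g-bumps ps acc) ⟩
    (counterValue acc + Σ pw ps) + w
      ≡⟨ solve 3 (λ c σ w → (c :+ σ) :+ w := c :+ (w :+ σ)) refl (counterValue acc) (Σ pw ps) w ⟩
    counterValue acc + (w + Σ pw ps)
      ∎
    where
    open ≡-Reasoning
    r : ℕ × ℕ × ℕ
    r = foldr g acc ps
    pw : (TEdge × Bool) × (TEdge × Bool) → ℚ
    pw (s , s′) = pairWeight e (map₂ weight s) (map₂ weight s′)
    w : ℚ
    w = pw (s , s′)
    counterValue-if : ∀ b → counterValue (if b then bump s s′ r else r)
                          ≡ counterValue r + (if b then weight (proj₂ s) * weight (proj₂ s′) else 0ℚ)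
    counterValue-if true  = counterValue-bump s s′ r
    counterValue-if false = sym (+-identityʳ _)

  value-stepEdge : ∀ s e coin →
    value (stepEdge T δ O s (e , coin)) ≡ value s + completions (weighted (expire e (stored s))) e
  value-stepEdge s e coin =
    trans (counterValue-foldr-bump e (λ _ _ _ → refl) (pairs st) (c₀ s , c₁ s , c₂ s))
          (cong (value s +_) (trans (Σ-pairs (λ s s′ → pairWeight e (map₂ weight s) (map₂ weight s′)) st)
                                    (sym (Σ<-map (pairWeight e) (map₂ weight) st))))
    where
    st : List (TEdge × Bool)
    st = expire e (stored s)

  storing-unbiased : ∀ (heavy : Bool) e st τ →
    p * streamCompletions (weighted (if heavy then st ∷ʳ (e , true) else st ∷ʳ (e , false))) τ
    + (1ℚ - p) * streamCompletions (weighted (if heavy then st ∷ʳ (e , true) else st)) τ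
    ≡ streamCompletions (weighted st ∷ʳ (e , 1ℚ)) τ
  storing-unbiased true  e st τ =
    trans (solve 2 (λ p s → p :* s :+ (con 1ℚ :- p) :* s := s) refl p _)
          (cong (λ L → streamCompletions L τ) (map-++ (map₂ weight) st [ e , true ]))
  storing-unbiased false e st τ = begin
    p * streamCompletions (weighted (st ∷ʳ (e , false))) τ + (1ℚ - p) * streamCompletions (weighted st) τ
      ≡⟨ cong₂ (λ L L′ → p * streamCompletions L τ + (1ℚ - p) * streamCompletions L′ τ)
               (map-++ (map₂ weight) st [ e , false ]) (sym (++-identityʳ (weighted st))) ⟩
    p * streamCompletions (weighted st ++ [ e , q ]) τ + (1ℚ - p) * streamCompletions (weighted st ++ []) τ
      ≡⟨ streamCompletions-sample p τ (weighted st) e q [] ⟩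
    streamCompletions (weighted st ∷ʳ (e , p * q)) τ
      ≡⟨ cong (λ w → streamCompletions (weighted st ∷ʳ (e , w)) τ) (*-inverseʳ p {{>-nonZero p>0}}) ⟩
    streamCompletions (weighted st ∷ʳ (e , 1ℚ)) τ
      ∎
    where open ≡-Reasoning

  run : State → List (TEdge × Bool) → State
  run = foldl (stepEdge T δ O)

  𝔼-value-run : ∀ τ → Linked (λ a b → time a < time b) τ → ∀ s →
    𝔼 (length τ) (λ cs → value (run s (zip τ cs))) ≡ value s + streamCompletions (weighted (stored s)) τ
  𝔼-value-run []      _      s = trans (𝔼-zero (λ _ → value s)) (sym (+-identityʳ (value s)))
  𝔼-value-run (e ∷ τ) sorted s = begin
    𝔼 (suc (length τ)) (λ cs → value (run s (zip (e ∷ τ) cs)))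
      ≡⟨ 𝔼-suc (length τ) _ ⟩
    p * 𝔼 (length τ) (λ cs → value (run sH (zip τ cs)))
      + (1ℚ - p) * 𝔼 (length τ) (λ cs → value (run sL (zip τ cs)))
      ≡⟨ cong₂ (λ x y → p * x + (1ℚ - p) * y)
               (𝔼-value-run τ (Linked.tail sorted) sH) (𝔼-value-run τ (Linked.tail sorted) sL) ⟩
    -- The counters do not depend on the coin, so value sL computes to value sH.
    p * (value sH + Ψ (stored sH)) + (1ℚ - p) * (value sH + Ψ (stored sL))
      ≡⟨ solve 4 (λ p v x y → p :* (v :+ x) :+ (con 1ℚ :- p) :* (v :+ y) := v :+ (p :* x :+ (con 1ℚ :- p) :* y))
           refl p (value sH) (Ψ (stored sH)) (Ψ (stored sL)) ⟩
    value sH + (p * Ψ (stored sH) + (1ℚ - p) * Ψ (stored sL))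
      ≡⟨ cong₂ _+_ (value-stepEdge s e true) (storing-unbiased (O e) e st τ) ⟩
    (value s + completions (weighted st) e) + streamCompletions (weighted st ∷ʳ (e , 1ℚ)) τ
      ≡⟨ +-assoc (value s) _ _ ⟩
    value s + streamCompletions (weighted st) (e ∷ τ)
      ≡⟨ cong (value s +_) (streamCompletions-expire sorted weight (stored s)) ⟩
    value s + streamCompletions (weighted (stored s)) (e ∷ τ)
      ∎
    where
    open ≡-Reasoning
    sH sL : State
    sH = stepEdge T δ O s (e , true)
    sL = stepEdge T δ O s (e , false)
    st : List (TEdge × Bool)
    st = expire e (stored s)
    Ψ : List (TEdge × Bool) → ℚ
    Ψ st′ = streamCompletions (weighted st′) τ

  value-initial : value (state [] 0 0 0) ≡ 0ℚ
  value-initial = solve 1 (λ q → con 0ℚ :* (q :* q) :+ con 0ℚ :* q :+ con 0ℚ := con 0ℚ) refl q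

-- runSTEP loops with a function local to its where-block; unification names it runSTEP-loop.
private
  mutual
    runSTEP-loop : Pattern → ℚ → (TEdge → Bool) → List TEdge → List Bool → State → List (TEdge × Bool) → State
    runSTEP-loop = _

    runSTEP-unfold : ∀ T δ O τ cs → runSTEP T δ O τ cs ≡ runSTEP-loop T δ O τ cs (state [] 0 0 0) (zip τ cs)
    runSTEP-unfold T δ O τ cs with state [] 0 0 0 | zip τ cs
    ... | s | xs = refl

runSTEP-foldl : ∀ T δ O τ cs → runSTEP T δ O τ cs ≡ foldl (stepEdge T δ O) (state [] 0 0 0) (zip τ cs)
runSTEP-foldl T δ O τ cs = trans (runSTEP-unfold T δ O τ cs) (loop-foldl (state [] 0 0 0) (zip τ cs))
  where
  loop-foldl : ∀ s xs → runSTEP-loop T δ O τ cs s xs ≡ foldl (stepEdge T δ O) s xs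
  loop-foldl s []       = refl
  loop-foldl s (x ∷ xs) = loop-foldl (stepEdge T δ O s x) xs

lemma1 : (τ : List TEdge) → ValidStream τ
       → (δ : ℚ) → 0ℚ < δ
       → (p : ℚ) → (p>0 : 0ℚ < p) → p ≤ 1ℚ
       → (O : TEdge → Bool)
       → (T : Pattern) → IsTriangle T
       → expectedOutput T δ O p p>0 τ ≡ ℕtoℚ (numInstances T δ τ)
lemma1 τ (sorted , _) δ _ p p>0 _ O T _ = begin
  expectedOutput T δ O p p>0 τ
    ≡⟨ Σ-cong (λ cs → cong (λ s → prob p cs * value s) (runSTEP-foldl T δ O τ cs)) (allCoins (length τ)) ⟩
  𝔼 (length τ) (λ cs → value (run (state [] 0 0 0) (zip τ cs)))
    ≡⟨ 𝔼-value-run τ sorted (state [] 0 0 0) ⟩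
  value (state [] 0 0 0) + streamCompletions [] τ
    ≡⟨ cong (_+ streamCompletions [] τ) value-initial ⟩
  0ℚ + streamCompletions [] τ
    ≡⟨ streamCompletions-unit τ [] ⟩
  Σ<< ι𝟙 τ
    ≡⟨ sym (ℕtoℚ-length-filter _ (triples τ)) ⟩
  ℕtoℚ (numInstances T δ τ)
    ∎
  where
  open ≡-Reasoning
  open STEP T δ O p p>0
  open Completions (isInstanceᵇ T δ)
  open Expectation p
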